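{- Let $R$ be a finite group of order $r$, identified with its right regular representation on the set $R$, and let $N$ be a non-identity proper normal subgroup of $R$ with $n:=|N|$. For $S\subseteq R$ let $\Gamma=\Gamma(R,S)$ and let $F_S$ be the subgroup of $\mathrm{Aut}(\Gamma)$ consisting of the automorphisms that fix setwise every coset of $N$ in $R$. Let $C$ be a coset of $N$ in $R$ with $C\neq N$. Then the number of subsets $S\subseteq R$ for which there exists $f\in F_S\cap N_{\mathrm{Aut}(\Gamma)}(N)$ with $1^f=1$ (where $1$ is the identity of $R$, viewed as a vertex) and with the restriction of $f$ to $C$ not the identity is at most $2^{\,r-\frac{n}{4}+(\log_2 n)^2+\log_2 n}$.
   Context: For a finite group $R$ and $S\subseteq R$, the Cayley digraph $\Gamma(R,S)$ has vertex set $R$ and $(g,h)$ is an arc iff $hg^{ -1}\in S$. $N$ is viewed as a subgroup of $\mathrm{Sym}(R)$ via right multiplication; its orbits are the cosets of $N$. $N_{\mathrm{Aut}(\Gamma)}(N)$ denotes the normaliser of $N$ in $\mathrm{Aut}(\Gamma)$. -}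

module Defs where

open import Data.Nat using (ℕ; suc; _*_; _^_; _≤_; _<_)
open import Data.Fin using (Fin)
open import Data.Fin.Subset using (Subset; _∈_; _∉_; ∣_∣)
open import Data.Fin.Permutation using (Permutation′; _⟨$⟩ʳ_)
open import Data.Product using (Σ; ∃; ∃-syntax; _×_)
open import Data.List using (List; length)
open import Data.List.Relation.Unary.All using (All)
open import Data.List.Relation.Unary.Unique.Propositional using (Unique)
open import Relation.Binary.PropositionalEquality using (_≡_; _≢_)
open import Relation.Nullary using (¬_)
open import Algebra.Structures using (IsGroup)
open import Function.Bundles using (_⇔_)

-- A finite group of order r, with underlying set Fin r (every finite group of
-- order r is isomorphic to one of this form).
record FinGroup (r : ℕ) : Set where
  field
    _·_     : Fin r → Fin r → Fin r
    e       : Fin r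
    _⁻¹     : Fin r → Fin r
    isGroup : IsGroup _≡_ _·_ e _⁻¹
  infixl 7 _·_
  infix 8 _⁻¹

module _ {r : ℕ} (G : FinGroup r) where
  open FinGroup G

  IsSubgroup : Subset r → Set
  IsSubgroup N = (e ∈ N)
               × (∀ x y → x ∈ N → y ∈ N → (x · y) ∈ N)
               × (∀ x → x ∈ N → (x ⁻¹) ∈ N)

  IsNormalSubgroup : Subset r → Set
  IsNormalSubgroup N = IsSubgroup N × (∀ g x → x ∈ N → (g ⁻¹ · x · g) ∈ N)

  NonTrivial : Subset r → Set
  NonTrivial N = ∃[ x ] (x ∈ N × x ≢ e)

  Proper : Subset r → Set
  Proper N = ∃[ x ] (x ∉ N)

  Arc : Subset r → Fin r → Fin r → Set
  Arc S g h = (h · g ⁻¹) ∈ S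

  IsAut : Subset r → Permutation′ r → Set
  IsAut S f = ∀ g h → Arc S g h ⇔ Arc S (f ⟨$⟩ʳ g) (f ⟨$⟩ʳ h)

  -- f fixes setwise every coset xN of N (the N-orbits under right multiplication)
  FixesCosets : Subset r → Permutation′ r → Set
  FixesCosets N f = ∀ x → ((x ⁻¹) · (f ⟨$⟩ʳ x)) ∈ N

  -- f normalises N (as a group of right multiplications): f ρ(N) f⁻¹ = ρ(N)
  Normalises : Subset r → Permutation′ r → Set
  Normalises N f =
      (∀ m → m ∈ N → ∃[ m′ ] (m′ ∈ N × (∀ x → f ⟨$⟩ʳ (x · m) ≡ (f ⟨$⟩ʳ x) · m′)))
    × (∀ m → m ∈ N → ∃[ m′ ] (m′ ∈ N × (∀ x → f ⟨$⟩ʳ (x · m′) ≡ (f ⟨$⟩ʳ x) · m)))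

  -- S is counted: ∃ f ∈ F_S ∩ N_{Aut Γ}(N) with 1^f = 1 and f|_C ≠ id, where C = cN
  Good : Subset r → Fin r → Subset r → Set
  Good N c S = ∃[ f ] ( IsAut S f
                       × FixesCosets N f
                       × Normalises N f
                       × f ⟨$⟩ʳ e ≡ e
                       × ∃[ m ] (m ∈ N × f ⟨$⟩ʳ (c · m) ≢ c · m))

-- "k ≤ 2^(r - n/4 + (log₂ n)² + log₂ n)" stated in ℕ.  With L = log₂ n this is
-- k⁴·2ⁿ ≤ 2^(4r)·n⁴·2^(4L²), which (by continuity/monotonicity, L ≥ 0) holds iff
-- for every rational p/q > L (i.e. nᑫ < 2ᵖ, q ≥ 1) we have
-- (k⁴·2ⁿ)^(q²) ≤ (2^(4r)·n⁴)^(q²) · 2^(4p²).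
BoundedBy : ℕ → ℕ → ℕ → Set
BoundedBy k r n =
  ∀ p q → 1 ≤ q → n ^ q < 2 ^ p →
    (k ^ 4 * 2 ^ n) ^ (q * q) ≤ (2 ^ (4 * r) * n ^ 4) ^ (q * q) * 2 ^ (4 * (p * p))

module Submission where

-- We show that the number k of good S satisfies k ≤ n^(d+1)·2^(r − n/4)
-- for some d with 2^d ≤ n; the stated bound follows by arithmetic.
--
--  * Generating sequence (module Generation): there are g₁, …, g_d ∈ N with
--    2^d ≤ n such that two permutations compatible with right multiplication
--    by N that agree at c, c·g₁, …, c·g_d agree on all of C.  The g's are found
--    greedily: adjoining m ∈ N with H·m disjoint from H doubles the set H of
--    points already determined.
--  * Free points (module FreePoints): for one such automorphism f₀, call x free
--    if x ∉ C, f₀ x = x, or x is smaller than f₀ x and f₀⁻¹ x.  C has at least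
--    as many moved as fixed points and at least as many non-minimal moved
--    points as local minima, so at most r − n/4 points are free; and a set
--    invariant under f₀ on C is determined by its free part.
--  * Counting (module GoodCount): an automorphism fixing 1 preserves S.
--    Classify the good S by the n^(d+1) possible values of f at c, c·g₁, …,
--    c·g_d; inside one class all f agree on C, so there are at most 2^(r − n/4)
--    sets per class.

open import Defs
open import Level using (0ℓ)
open import Data.Nat using (ℕ; zero; suc; _+_; _*_; _^_; _∸_; _≤_; _<_; z≤n; s≤s)
open import Data.Nat.Properties
open import Data.Nat.DivMod using (_/_; m*n/n≡m; /-monoˡ-≤; m/n*n≤m)
open import Data.Nat.Induction using (<-rec)
open import Data.Nat.Tactic.RingSolver using (solve-∀)
open import Data.Bool using (Bool; true; false; _∧_; _∨_; not; if_then_else_)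
import Data.Bool.Properties as Bool
open import Data.Fin using (Fin; zero; suc; toℕ)
import Data.Fin.Properties as Fin
open import Data.Fin.Subset using (Subset; _∈_; _∉_; ∣_∣)
open import Data.Fin.Permutation using (Permutation′; _⟨$⟩ʳ_; _⟨$⟩ˡ_)
import Data.Fin.Permutation as Permutation
open import Data.List using (List; []; _∷_; length; map; _++_; filter)
open import Data.List.Properties using (length-map; length-++; ∷-injective)
open import Data.List.Membership.Propositional using () renaming (_∈_ to _∈ₗ_)
open import Data.List.Membership.Propositional.Properties using (∈-∃++; ∈-++⁻; ∈-++⁺ˡ; ∈-++⁺ʳ; ∈-map⁺)
open import Data.List.Relation.Unary.All as All using (All; []; _∷_)
import Data.List.Relation.Unary.All.Properties as All
open import Data.List.Relation.Unary.Any using (here; there)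
open import Data.List.Relation.Unary.AllPairs using (AllPairs; []; _∷_)
import Data.List.Relation.Unary.AllPairs.Properties as AllPairs
open import Data.List.Relation.Unary.Unique.Propositional using (Unique)
import Data.List.Relation.Unary.Unique.Propositional.Properties as Unique
open import Data.Vec using ([]; _∷_; lookup; tabulate)
open import Data.Vec.Properties using (lookup∘tabulate; tabulate∘lookup; tabulate-cong; []=⇒lookup; lookup⇒[]=)
open import Data.Product using (Σ; ∃-syntax; _×_; _,_; proj₁; proj₂)
open import Data.Sum using (_⊎_; inj₁; inj₂)
open import Data.Unit using (⊤; tt)
open import Data.Empty using (⊥-elim)
open import Relation.Nullary using (¬_; Dec; yes; no; does)
open import Relation.Nullary.Decidable using (dec-true; dec-false; _×-dec_; _→-dec_)
open import Relation.Unary using (Decidable)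
open import Relation.Unary.Properties using (∁?)
open import Relation.Binary.Definitions using (DecidableEquality; tri<; tri≈; tri>)
open import Relation.Binary.PropositionalEquality
open import Function using (_∘_)
open import Function.Bundles using (Injection; Equivalence; _⇔_; mk⇔)
open import Function.Properties.Inverse using (↔⇒↣)
open import Algebra.Bundles using (Group)
open import Algebra.Structures using (IsGroup)
import Algebra.Properties.Group as GroupProperties

pigeonhole : {A : Set} (L E : List A) → Unique L → All (_∈ₗ E) L → length L ≤ length E
pigeonhole [] E _ _ = z≤n
pigeonhole (x ∷ L) E (x∉L ∷ uniqueL) (x∈E ∷ L⊆E) with ∈-∃++ x∈E
... | us , vs , refl = subst (suc (length L) ≤_) (sym length-hole)
        (s≤s (pigeonhole L (us ++ vs) uniqueL (All.zipWith drop-x (x∉L , L⊆E))))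
  where
  drop-x : ∀ {y} → x ≢ y × y ∈ₗ us ++ x ∷ vs → y ∈ₗ us ++ vs
  drop-x (x≢y , y∈E) with ∈-++⁻ us y∈E
  ... | inj₁ y∈us = ∈-++⁺ˡ y∈us
  ... | inj₂ (here y≡x) = ⊥-elim (x≢y (sym y≡x))
  ... | inj₂ (there y∈vs) = ∈-++⁺ʳ us y∈vs
  length-hole : length (us ++ x ∷ vs) ≡ suc (length (us ++ vs))
  length-hole = begin
    length (us ++ x ∷ vs)           ≡⟨ length-++ us ⟩
    length us + suc (length vs)     ≡⟨ +-suc (length us) (length vs) ⟩
    suc (length us + length vs)     ≡⟨ cong suc (length-++ us) ⟨
    suc (length (us ++ vs))         ∎
    where open ≡-Reasoning

map-separating : {A B : Set} {R : A → A → Set} (h : A → B) {L : List A} →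
  (∀ {x y} → x ∈ₗ L → y ∈ₗ L → R x y → h x ≢ h y) → AllPairs R L → Unique (map h L)
map-separating h {[]} separates [] = []
map-separating {R = R} h {x ∷ L} separates (Rx ∷ distinct) =
  separated-from-x Rx (λ y∈M → y∈M) ∷ map-separating h (λ x∈ y∈ → separates (there x∈) (there y∈)) distinct
  where
  separated-from-x : ∀ {M} → All (R x) M → (∀ {y} → y ∈ₗ M → y ∈ₗ L) → All (h x ≢_) (map h M)
  separated-from-x [] _ = []
  separated-from-x (Rxy ∷ Rxs) M⊆L =
    separates (here refl) (there (M⊆L (here refl))) Rxy ∷ separated-from-x Rxs (M⊆L ∘ there)

length-filter-split : {A : Set} {P : A → Set} (P? : Decidable P) (xs : List A) →
  length xs ≡ length (filter P? xs) + length (filter (∁? P?) xs)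
length-filter-split P? [] = refl
length-filter-split P? (x ∷ xs) with P? x
... | yes _ = cong suc (length-filter-split P? xs)
... | no _ = trans (cong suc (length-filter-split P? xs)) (sym (+-suc _ _))

module Classification {A B : Set} (R : A → A → Set) (_≟_ : DecidableEquality B) where

  Bounded : (A → Set) → ℕ → Set
  Bounded P M = ∀ L → AllPairs R L → All P L → length L ≤ M

  fibre-count : ∀ {P : A → Set} {M} (h : A → B) (E : List B) →
    (∀ b → Bounded (λ x → P x × h x ≡ b) M) → Bounded (λ x → P x × h x ∈ₗ E) (length E * M)
  fibre-count h [] bound [] _ _ = z≤n
  fibre-count h [] bound (x ∷ L) _ ((_ , ()) ∷ _)
  fibre-count {P} {M} h (b ∷ E) bound L distinct inE = begin
    length L                                                ≡⟨ length-filter-split over-b L ⟩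
    length (filter over-b L) + length (filter (∁? over-b) L) ≤⟨ +-mono-≤ in-fibre in-rest ⟩
    M + length E * M                                        ∎
    where
    open ≤-Reasoning
    over-b : Decidable (λ x → h x ≡ b)
    over-b x = h x ≟ b
    in-fibre : length (filter over-b L) ≤ M
    in-fibre = bound b _ (AllPairs.filter⁺ over-b distinct)
      (All.zipWith (λ ((Px , _) , hx≡b) → Px , hx≡b) (All.filter⁺ over-b inE , All.all-filter over-b L))
    other-point : ∀ {x} → (P x × h x ∈ₗ b ∷ E) × ¬ h x ≡ b → P x × h x ∈ₗ E
    other-point ((Px , here hx≡b) , hx≢b) = ⊥-elim (hx≢b hx≡b)
    other-point ((Px , there hx∈E) , _) = Px , hx∈E
    in-rest : length (filter (∁? over-b) L) ≤ length E * M
    in-rest = fibre-count h E bound _ (AllPairs.filter⁺ (∁? over-b) distinct)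
      (All.zipWith other-point (All.filter⁺ (∁? over-b) inE , All.all-filter (∁? over-b) L))

  key : List (A → B) → A → List B
  key hs x = map (λ h → h x) hs

  same-key : ∀ hs {x y} → key hs x ≡ key hs y → All (λ h → h x ≡ h y) hs
  same-key [] _ = []
  same-key (h ∷ hs) keys≡ = proj₁ (∷-injective keys≡) ∷ same-key hs (proj₂ (∷-injective keys≡))

  classify : ∀ {P : A → Set} {M} (E : List B) (hs : List (A → B)) →
    (∀ v → Bounded (λ x → P x × key hs x ≡ v) M) →
    Bounded (λ x → P x × All (λ h → h x ∈ₗ E) hs) (length E ^ length hs * M)
  classify {P} {M} E [] bound L distinct entries =
    subst (length L ≤_) (sym (+-identityʳ M)) (bound [] L distinct (All.map (λ (Px , _) → Px , refl) entries))
  classify {P} {M} E (h ∷ hs) bound L distinct entries =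
    subst (length L ≤_) (sym (*-assoc (length E) (length E ^ length hs) M))
      (fibre-count h E by-value-of-h L distinct (All.map (λ { (Px , (hx∈E ∷ rest)) → (Px , rest) , hx∈E }) entries))
    where
    by-value-of-h : ∀ b → Bounded (λ x → (P x × All (λ h → h x ∈ₗ E) hs) × h x ≡ b) (length E ^ length hs * M)
    by-value-of-h b L′ distinct′ entries′ =
      classify {P = λ x → P x × h x ≡ b} E hs
        (λ v L″ distinct″ entries″ → bound (b ∷ v) L″ distinct″
           (All.map (λ ((Px , hx≡b) , key≡v) → Px , cong₂ _∷_ hx≡b key≡v) entries″))
        L′ distinct′ (All.map (λ ((Px , rest) , hx≡b) → (Px , hx≡b) , rest) entries′)

count : ∀ {r} → (Fin r → Bool) → ℕ
count {zero} p = 0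
count {suc r} p = if p zero then suc (count (p ∘ suc)) else count (p ∘ suc)

enum : ∀ {r} → (Fin r → Bool) → List (Fin r)
enum {zero} p = []
enum {suc r} p = if p zero then zero ∷ map suc (enum (p ∘ suc)) else map suc (enum (p ∘ suc))

enum-length : ∀ {r} (p : Fin r → Bool) → length (enum p) ≡ count p
enum-length {zero} p = refl
enum-length {suc r} p with p zero
... | true = cong suc (trans (length-map suc (enum (p ∘ suc))) (enum-length (p ∘ suc)))
... | false = trans (length-map suc (enum (p ∘ suc))) (enum-length (p ∘ suc))

∈-enum : ∀ {r} (p : Fin r → Bool) x → p x ≡ true → x ∈ₗ enum p
∈-enum {suc r} p zero px with p zero
... | true = here refl
∈-enum {suc r} p zero () | false
∈-enum {suc r} p (suc x) px with p zero
... | true = there (∈-map⁺ suc (∈-enum (p ∘ suc) x px))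
... | false = ∈-map⁺ suc (∈-enum (p ∘ suc) x px)

enum-sound : ∀ {r} (p : Fin r → Bool) → All (λ x → p x ≡ true) (enum p)
enum-sound {zero} p = []
enum-sound {suc r} p with p zero in p0
... | true = p0 ∷ All.map⁺ (enum-sound (p ∘ suc))
... | false = All.map⁺ (enum-sound (p ∘ suc))

enum-unique : ∀ {r} (p : Fin r → Bool) → Unique (enum p)
enum-unique {zero} p = []
enum-unique {suc r} p with p zero
... | true = All.map⁺ (All.universal (λ _ ()) _) ∷ Unique.map⁺ Fin.suc-injective (enum-unique (p ∘ suc))
... | false = Unique.map⁺ Fin.suc-injective (enum-unique (p ∘ suc))

count-injection : ∀ {r} (p q : Fin r → Bool) (h : Fin r → Fin r) →
  (∀ x y → p x ≡ true → p y ≡ true → h x ≡ h y → x ≡ y) →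
  (∀ x → p x ≡ true → q (h x) ≡ true) → count p ≤ count q
count-injection p q h injective maps-to = begin
  count p                  ≡⟨ trans (length-map h (enum p)) (enum-length p) ⟨
  length (map h (enum p))  ≤⟨ pigeonhole _ (enum q) images-unique (All.map⁺ (All.map into-q (enum-sound p))) ⟩
  length (enum q)          ≡⟨ enum-length q ⟩
  count q                  ∎
  where
  open ≤-Reasoning
  images-unique : Unique (map h (enum p))
  images-unique = map-separating h (λ x∈ y∈ x≢y → x≢y ∘ injective _ _ (All.lookup (enum-sound p) x∈) (All.lookup (enum-sound p) y∈))
    (enum-unique p)
  into-q : ∀ {x} → p x ≡ true → h x ∈ₗ enum q
  into-q {x} px = ∈-enum q (h x) (maps-to x px)

count-mono : ∀ {r} (p q : Fin r → Bool) → (∀ x → p x ≡ true → q x ≡ true) → count p ≤ count q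
count-mono p q p⊆q = count-injection p q (λ x → x) (λ _ _ _ _ x≡y → x≡y) p⊆q

count-positive : ∀ {r} (p : Fin r → Bool) x → p x ≡ true → 1 ≤ count p
count-positive p x px = subst (1 ≤_) (enum-length p) (pigeonhole (x ∷ []) (enum p) ([] ∷ []) (∈-enum p x px ∷ []))

count-ext : ∀ {r} (p q : Fin r → Bool) → (∀ x → p x ≡ q x) → count p ≡ count q
count-ext {zero} p q p≗q = refl
count-ext {suc r} p q p≗q rewrite p≗q zero with q zero
... | true = cong suc (count-ext (p ∘ suc) (q ∘ suc) (p≗q ∘ suc))
... | false = count-ext (p ∘ suc) (q ∘ suc) (p≗q ∘ suc)

count-split : ∀ {r} (p q : Fin r → Bool) → count p ≡ count (λ x → p x ∧ q x) + count (λ x → p x ∧ not (q x))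
count-split {zero} p q = refl
count-split {suc r} p q with p zero | q zero
... | true | true = cong suc (count-split (p ∘ suc) (q ∘ suc))
... | true | false = trans (cong suc (count-split (p ∘ suc) (q ∘ suc))) (sym (+-suc _ _))
... | false | _ = count-split (p ∘ suc) (q ∘ suc)

count-≤ : ∀ {r} (p : Fin r → Bool) → count p ≤ r
count-≤ {zero} p = z≤n
count-≤ {suc r} p with p zero
... | true = s≤s (count-≤ (p ∘ suc))
... | false = m≤n⇒m≤1+n (count-≤ (p ∘ suc))

count-full : ∀ {r} (p : Fin r → Bool) → (∀ x → p x ≡ true) → count p ≡ r
count-full {zero} p _ = refl
count-full {suc r} p all-true rewrite all-true zero = cong suc (count-full (p ∘ suc) (all-true ∘ suc))

count-empty : ∀ {r} (p : Fin r → Bool) → (∀ x → p x ≡ false) → count p ≡ 0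
count-empty {zero} p _ = refl
count-empty {suc r} p all-false rewrite all-false zero = count-empty (p ∘ suc) (all-false ∘ suc)

∣∣≡count : ∀ {r} (V : Subset r) → ∣ V ∣ ≡ count (lookup V)
∣∣≡count [] = refl
∣∣≡count (true ∷ V) = cong suc (∣∣≡count V)
∣∣≡count (false ∷ V) = ∣∣≡count V

subset-ext : ∀ {r} (S T : Subset r) → (∀ x → lookup S x ≡ lookup T x) → S ≡ T
subset-ext S T S≗T = trans (sym (tabulate∘lookup S)) (trans (tabulate-cong S≗T) (tabulate∘lookup T))

subsetsWithin : ∀ {r} → (Fin r → Bool) → List (Subset r)
subsetsWithin {zero} p = [] ∷ []
subsetsWithin {suc r} p =
  if p zero then map (true ∷_) (subsetsWithin (p ∘ suc)) ++ map (false ∷_) (subsetsWithin (p ∘ suc))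
            else map (false ∷_) (subsetsWithin (p ∘ suc))

length-subsetsWithin : ∀ {r} (p : Fin r → Bool) → length (subsetsWithin p) ≡ 2 ^ count p
length-subsetsWithin {zero} p = refl
length-subsetsWithin {suc r} p with p zero
... | true = begin
    length (map (true ∷_) T ++ map (false ∷_) T)           ≡⟨ length-++ (map (true ∷_) T) ⟩
    length (map (true ∷_) T) + length (map (false ∷_) T)   ≡⟨ cong₂ _+_ (length-map _ T) (length-map _ T) ⟩
    length T + length T                                     ≡⟨ cong (λ k → k + k) (length-subsetsWithin (p ∘ suc)) ⟩
    2 ^ count (p ∘ suc) + 2 ^ count (p ∘ suc)               ≡⟨ cong (2 ^ count (p ∘ suc) +_) (+-identityʳ _) ⟨
    2 ^ suc (count (p ∘ suc))                               ∎
  where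
  open ≡-Reasoning
  T = subsetsWithin (p ∘ suc)
... | false = trans (length-map (false ∷_) (subsetsWithin (p ∘ suc))) (length-subsetsWithin (p ∘ suc))

∈-subsetsWithin : ∀ {r} (p : Fin r → Bool) (T : Subset r) → (∀ x → lookup T x ≡ true → p x ≡ true) → T ∈ₗ subsetsWithin p
∈-subsetsWithin {zero} p [] _ = here refl
∈-subsetsWithin {suc r} p (b ∷ T) T⊆p with p zero in p0
∈-subsetsWithin {suc r} p (true ∷ T) T⊆p | true =
  ∈-++⁺ˡ (∈-map⁺ (true ∷_) (∈-subsetsWithin (p ∘ suc) T (T⊆p ∘ suc)))
∈-subsetsWithin {suc r} p (false ∷ T) T⊆p | true =
  ∈-++⁺ʳ (map (true ∷_) (subsetsWithin (p ∘ suc))) (∈-map⁺ (false ∷_) (∈-subsetsWithin (p ∘ suc) T (T⊆p ∘ suc)))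
∈-subsetsWithin {suc r} p (true ∷ T) T⊆p | false with () ← trans (sym (T⊆p zero refl)) p0
∈-subsetsWithin {suc r} p (false ∷ T) T⊆p | false = ∈-map⁺ (false ∷_) (∈-subsetsWithin (p ∘ suc) T (T⊆p ∘ suc))

module _ {A : Set} where
  does-true : (a? : Dec A) → does a? ≡ true → A
  does-true (yes a) _ = a

  does-false : (a? : Dec A) → does a? ≡ false → ¬ A
  does-false (no ¬a) _ = ¬a

∧-true : ∀ {a b} → (a ∧ b) ≡ true → a ≡ true × b ≡ true
∧-true {true} b≡true = refl , b≡true

true-∧-true : ∀ {a b} → a ≡ true → b ≡ true → (a ∧ b) ≡ true
true-∧-true refl refl = refl

not-true : ∀ {a} → not a ≡ true → a ≡ false
not-true {false} _ = refl

false-not : ∀ {a} → a ≡ false → not a ≡ true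
false-not refl = refl

module GroupFacts {r : ℕ} (G : FinGroup r) where
  open FinGroup G public
  open IsGroup isGroup public using (assoc; identityʳ)

  asGroup : Group 0ℓ 0ℓ
  asGroup = record { isGroup = isGroup }

  open GroupProperties asGroup public
    using (∙-cancelˡ; ∙-cancelʳ; ⁻¹-anti-homo-∙; ε⁻¹≈ε)
    renaming ( \\-leftDividesˡ to x·[x⁻¹·y]≡y ; \\-leftDividesʳ to x⁻¹·[x·y]≡y
             ; //-rightDividesˡ to [y·x⁻¹]·x≡y ; //-rightDividesʳ to [y·x]·x⁻¹≡y )

-- Two
-- such permutations that agree on c·g for a few well-chosen g ∈ N already
-- agree on the whole coset cN; the number of points needed is logarithmic
-- in |N|.
module Generation {r : ℕ} (G : FinGroup r) (N : Subset r) (N≤G : IsSubgroup G N) (c : Fin r) where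
  open GroupFacts G

  -- f turns right multiplication by each m ∈ N into right multiplication by
  -- some m′ ∈ N (one half of "f normalises N").
  RightCompatible : Permutation′ r → Set
  RightCompatible f = ∀ m → m ∈ N → ∃[ m′ ] (m′ ∈ N × (∀ x → f ⟨$⟩ʳ (x · m) ≡ (f ⟨$⟩ʳ x) · m′))

  Agree : Permutation′ r → Permutation′ r → Fin r → Set
  Agree f₁ f₂ x = f₁ ⟨$⟩ʳ x ≡ f₂ ⟨$⟩ʳ x

  -- If compatible f₁, f₂ agree at x and at x·m, then m is sent to the same m′
  -- by both, so agreement at any y propagates to y·m.
  agreement-propagates : ∀ f₁ f₂ → RightCompatible f₁ → RightCompatible f₂ → ∀ m → m ∈ N → ∀ x →
    Agree f₁ f₂ x → Agree f₁ f₂ (x · m) → ∀ y → Agree f₁ f₂ y → Agree f₁ f₂ (y · m)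
  agreement-propagates f₁ f₂ compat₁ compat₂ m m∈N x at-x at-xm y at-y
    with compat₁ m m∈N | compat₂ m m∈N
  ... | m₁ , _ , shift₁ | m₂ , _ , shift₂ = begin
      f₁ ⟨$⟩ʳ (y · m)    ≡⟨ shift₁ y ⟩
      (f₁ ⟨$⟩ʳ y) · m₁   ≡⟨ cong₂ _·_ at-y m₁≡m₂ ⟩
      (f₂ ⟨$⟩ʳ y) · m₂   ≡⟨ shift₂ y ⟨
      f₂ ⟨$⟩ʳ (y · m)    ∎
    where
    open ≡-Reasoning
    m₁≡m₂ : m₁ ≡ m₂
    m₁≡m₂ = ∙-cancelˡ (f₁ ⟨$⟩ʳ x) m₁ m₂ (begin
      (f₁ ⟨$⟩ʳ x) · m₁   ≡⟨ shift₁ x ⟨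
      f₁ ⟨$⟩ʳ (x · m)    ≡⟨ at-xm ⟩
      f₂ ⟨$⟩ʳ (x · m)    ≡⟨ shift₂ x ⟩
      (f₂ ⟨$⟩ʳ x) · m₂   ≡⟨ cong (_· m₂) at-x ⟨
      (f₁ ⟨$⟩ʳ x) · m₂   ∎)

  AgreeOn : Permutation′ r → Permutation′ r → List (Fin r) → Set
  AgreeOn f₁ f₂ gs = All (λ g → Agree f₁ f₂ (c · g)) (e ∷ gs)

  agree-at-c : ∀ {f₁ f₂ gs} → AgreeOn f₁ f₂ gs → Agree f₁ f₂ c
  agree-at-c {f₁} {f₂} (at-c ∷ _) = subst (λ z → f₁ ⟨$⟩ʳ z ≡ f₂ ⟨$⟩ʳ z) (identityʳ c) at-c

  Determines : List (Fin r) → (Fin r → Bool) → Set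
  Determines gs H = ∀ f₁ f₂ → RightCompatible f₁ → RightCompatible f₂ →
    AgreeOn f₁ f₂ gs → ∀ h → H h ≡ true → Agree f₁ f₂ (c · h)

  record GeneratingSequence : Set where
    field
      gens        : List (Fin r)
      logarithmic : 2 ^ length gens ≤ count (lookup N)
      determines  : Determines gens (lookup N)

  record Stage (gs : List (Fin r)) (H : Fin r → Bool) : Set where
    field
      within-N   : ∀ h → H h ≡ true → h ∈ N
      has-e      : H e ≡ true
      large      : 2 ^ length gs ≤ count H
      determines : Determines gs H

  initial-stage : Stage [] (λ x → does (x Fin.≟ e))
  initial-stage = record
    { within-N = λ x x≡e → subst (_∈ N) (sym (is-e x x≡e)) (proj₁ N≤G)
    ; has-e = e-is-e
    ; large = count-positive _ e e-is-e
    ; determines = λ f₁ f₂ _ _ agree x x≡e → subst (λ z → Agree f₁ f₂ (c · z)) (sym (is-e x x≡e)) (All.head agree)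
    }
    where
    is-e : ∀ x → does (x Fin.≟ e) ≡ true → x ≡ e
    is-e x = does-true (x Fin.≟ e)
    e-is-e : does (e Fin.≟ e) ≡ true
    e-is-e = dec-true (e Fin.≟ e) refl

  Covered : (Fin r → Bool) → Fin r → Set
  Covered H m = lookup N m ≡ true → ∃[ h ] (H h ≡ true × H (h · m) ≡ true)

  covered? : ∀ H m → Dec (Covered H m)
  covered? H m = (lookup N m Bool.≟ true) →-dec Fin.any? (λ h → (H h Bool.≟ true) ×-dec (H (h · m) Bool.≟ true))

  -- Once every element of N is covered, gs determines all of N: for m ∈ N with
  -- h, h·m ∈ H, agreement at c·h and c·h·m propagates from c to c·m.
  saturated : ∀ {gs H} → Stage gs H → (∀ m → Covered H m) → GeneratingSequence
  saturated {gs} {H} stage covered = record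
    { gens = gs
    ; logarithmic = ≤-trans (Stage.large stage) (count-mono H (lookup N) (λ h Hh → []=⇒lookup (Stage.within-N stage h Hh)))
    ; determines = determines-N
    }
    where
    determines-N : Determines gs (lookup N)
    determines-N f₁ f₂ compat₁ compat₂ agree m m∈N with covered m m∈N
    ... | h , Hh , Hhm = agreement-propagates f₁ f₂ compat₁ compat₂ m (lookup⇒[]= m N m∈N) (c · h)
          (Stage.determines stage f₁ f₂ compat₁ compat₂ agree h Hh)
          (subst (Agree f₁ f₂) (sym (assoc c h m)) (Stage.determines stage f₁ f₂ compat₁ compat₂ agree (h · m) Hhm))
          c (agree-at-c {f₁} {f₂} agree)

  extend : (Fin r → Bool) → Fin r → Fin r → Bool
  extend H m x = H x ∨ H (x · m ⁻¹)

  extend-doubles : ∀ H m → (∀ h → H h ≡ true → H (h · m) ≡ false) → count H + count H ≤ count (extend H m)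
  extend-doubles H m disjoint = begin
    count H + count H        ≤⟨ +-monoʳ-≤ (count H) translate-into-new ⟩
    count H + count New      ≡⟨ cong (_+ count New) (count-ext Old H old-part) ⟨
    count Old + count New    ≡⟨ count-split (extend H m) H ⟨
    count (extend H m)       ∎
    where
    open ≤-Reasoning
    Old New : Fin r → Bool
    Old x = extend H m x ∧ H x
    New x = extend H m x ∧ not (H x)
    old-part : ∀ x → Old x ≡ H x
    old-part x with H x
    ... | true = refl
    ... | false = Bool.∧-zeroʳ _
    translate-into-new : count H ≤ count New
    translate-into-new = count-injection H New (_· m) (λ x y _ _ → ∙-cancelʳ m x y) into-new
      where
      into-new : ∀ h → H h ≡ true → New (h · m) ≡ true
      into-new h Hh rewrite disjoint h Hh | [y·x]·x⁻¹≡y m h | Hh = refl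

  -- Adjoining m keeps the invariant: H·m ⊆ N, and agreement on cH propagates
  -- to cHm once the two permutations also agree at c·m.
  extend-stage : ∀ {gs H} → Stage gs H → ∀ m → lookup N m ≡ true → (∀ h → H h ≡ true → H (h · m) ≡ false) →
    Stage (m ∷ gs) (extend H m)
  extend-stage {gs} {H} stage m m∈N disjoint = record
    { within-N = within-N
    ; has-e = cong (_∨ H (e · m ⁻¹)) (Stage.has-e stage)
    ; large = ≤-trans (+-mono-≤ (Stage.large stage) (≤-trans (≤-reflexive (+-identityʳ _)) (Stage.large stage)))
                      (extend-doubles H m disjoint)
    ; determines = determines
    }
    where
    within-N : ∀ x → extend H m x ≡ true → x ∈ N
    within-N x ext with H x in Hx
    ... | true = Stage.within-N stage x Hx
    ... | false = subst (_∈ N) ([y·x⁻¹]·x≡y m x)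
                    (proj₁ (proj₂ N≤G) _ _ (Stage.within-N stage _ ext) (lookup⇒[]= m N m∈N))
    determines : Determines (m ∷ gs) (extend H m)
    determines f₁ f₂ compat₁ compat₂ (at-c ∷ at-cm ∷ agree) x ext with H x in Hx
    ... | true = Stage.determines stage f₁ f₂ compat₁ compat₂ (at-c ∷ agree) x Hx
    ... | false = subst (Agree f₁ f₂) (trans (assoc c (x · m ⁻¹) m) (cong (c ·_) ([y·x⁻¹]·x≡y m x)))
          (agreement-propagates f₁ f₂ compat₁ compat₂ m (lookup⇒[]= m N m∈N)
             c (agree-at-c {f₁} {f₂} (at-c ∷ agree)) at-cm
             (c · (x · m ⁻¹)) (Stage.determines stage f₁ f₂ compat₁ compat₂ (at-c ∷ agree) _ ext))

  -- Adjoin uncovered elements until every element of N is covered.  Each round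
  -- strictly enlarges H ⊆ Fin r, so the fuel bound r < fuel + |H| suffices.
  grow : ∀ fuel {gs H} → Stage gs H → r < fuel + count H → GeneratingSequence
  grow fuel {H = H} stage room with Fin.all? (covered? H)
  ... | yes covered = saturated stage covered
  grow zero {H = H} stage room | no _ = ⊥-elim (<⇒≱ room (count-≤ H))
  grow (suc fuel) {H = H} stage room | no not-all with Fin.¬∀⟶∃¬ r (Covered H) (covered? H) not-all
  ... | m , uncovered with lookup N m in m∈N
  ... | false = ⊥-elim (uncovered (λ ()))
  ... | true = grow fuel (extend-stage stage m m∈N disjoint) room′
    where
    disjoint : ∀ h → H h ≡ true → H (h · m) ≡ false
    disjoint h Hh with H (h · m) in Hhm
    ... | true = ⊥-elim (uncovered (λ _ → h , Hh , Hhm))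
    ... | false = refl
    grows : count H < count (extend H m)
    grows = ≤-trans (+-monoˡ-≤ (count H) (count-positive H e (Stage.has-e stage))) (extend-doubles H m disjoint)
    room′ : r < fuel + count (extend H m)
    room′ = ≤-trans room (subst (_≤ fuel + count (extend H m)) (+-suc fuel (count H)) (+-monoʳ-≤ fuel grows))

  generating-sequence : GeneratingSequence
  generating-sequence = grow r initial-stage (≤-trans (≤-reflexive (+-comm 1 r)) (+-monoʳ-≤ r (Stage.large initial-stage)))

perm-injective : ∀ {r} (f : Permutation′ r) {x y} → f ⟨$⟩ʳ x ≡ f ⟨$⟩ʳ y → x ≡ y
perm-injective f = Injection.injective (↔⇒↣ f)

module Coset {r : ℕ} (G : FinGroup r) (N : Subset r) (N≤G : IsSubgroup G N) (c : Fin r) where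
  open GroupFacts G

  private
    ·-closed = proj₁ (proj₂ N≤G)
    ⁻¹-closed = proj₂ (proj₂ N≤G)

  inC : Fin r → Bool
  inC x = lookup N (c ⁻¹ · x)

  coset-step : ∀ a b → inC a ≡ true → (a ⁻¹ · b) ∈ N → inC b ≡ true
  coset-step a b a∈C a⁻¹b∈N =
    subst (λ z → lookup N z ≡ true) (trans (assoc _ _ _) (cong (c ⁻¹ ·_) (x·[x⁻¹·y]≡y a b)))
    ([]=⇒lookup (·-closed _ _ (lookup⇒[]= _ N a∈C) a⁻¹b∈N))

  coset-step⁻ : ∀ a b → inC b ≡ true → (a ⁻¹ · b) ∈ N → inC a ≡ true
  coset-step⁻ a b b∈C a⁻¹b∈N = subst (λ z → lookup N z ≡ true) c⁻¹a
    ([]=⇒lookup (·-closed _ _ (lookup⇒[]= _ N b∈C) (⁻¹-closed _ a⁻¹b∈N)))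
    where
    open ≡-Reasoning
    c⁻¹a : c ⁻¹ · b · (a ⁻¹ · b) ⁻¹ ≡ c ⁻¹ · a
    c⁻¹a = begin
      c ⁻¹ · b · (a ⁻¹ · b) ⁻¹              ≡⟨ cong (λ z → c ⁻¹ · z · (a ⁻¹ · b) ⁻¹) (x·[x⁻¹·y]≡y a b) ⟨
      c ⁻¹ · (a · (a ⁻¹ · b)) · (a ⁻¹ · b) ⁻¹ ≡⟨ cong (_· (a ⁻¹ · b) ⁻¹) (assoc _ _ _) ⟨
      c ⁻¹ · a · (a ⁻¹ · b) · (a ⁻¹ · b) ⁻¹   ≡⟨ [y·x]·x⁻¹≡y _ _ ⟩
      c ⁻¹ · a                               ∎

  N≤C : count (lookup N) ≤ count inC
  N≤C = count-injection (lookup N) inC (c ·_) (λ x y _ _ → ∙-cancelˡ c x y)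
    (λ x x∈N → subst (λ z → lookup N z ≡ true) (sym (x⁻¹·[x·y]≡y c x)) x∈N)

-- In a Cayley digraph Γ(R,S) the out-neighbours of the identity are exactly
-- S, so an automorphism fixing the identity maps S onto itself.
module CayleyFacts {r : ℕ} (G : FinGroup r) where
  open GroupFacts G

  aut-preserves-connection-set : ∀ S f → IsAut G S f → f ⟨$⟩ʳ e ≡ e → ∀ z → lookup S z ≡ lookup S (f ⟨$⟩ʳ z)
  aut-preserves-connection-set S f aut fe z = Bool.⇔→≡ {z = true} (mk⇔
    (λ Sz → []=⇒lookup (Equivalence.to arc-from-e (lookup⇒[]= z S Sz)))
    (λ Sfz → []=⇒lookup (Equivalence.from arc-from-e (lookup⇒[]= _ S Sfz))))
    where
    y·e⁻¹≡y : ∀ y → y · e ⁻¹ ≡ y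
    y·e⁻¹≡y y = trans (cong (y ·_) ε⁻¹≈ε) (identityʳ y)
    y·[fe]⁻¹≡y : ∀ y → y · (f ⟨$⟩ʳ e) ⁻¹ ≡ y
    y·[fe]⁻¹≡y y = trans (cong (λ w → y · w ⁻¹) fe) (y·e⁻¹≡y y)
    arc-from-e : (z ∈ S) ⇔ (f ⟨$⟩ʳ z ∈ S)
    arc-from-e = mk⇔
      (λ z∈S → subst (_∈ S) (y·[fe]⁻¹≡y _) (Equivalence.to (aut e z) (subst (_∈ S) (sym (y·e⁻¹≡y z)) z∈S)))
      (λ fz∈S → subst (_∈ S) (y·e⁻¹≡y z) (Equivalence.from (aut e z) (subst (_∈ S) (sym (y·[fe]⁻¹≡y _)) fz∈S)))

-- If C splits into parts of sizes f, l, x with l ≤ x and f ≤ l + x, then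
-- f + l ≤ ¾|C|; stated with a further a points outside C, in the shape
-- 4·(free points) + |C| ≤ 4·(all points).
quarter-bound : ∀ a f l x → l ≤ x → f ≤ l + x → 4 * (a + (f + l)) + (f + (l + x)) ≤ 4 * (f + (l + x) + a)
quarter-bound a f l x l≤x f≤l+x = begin
  4 * (a + (f + l)) + (f + (l + x))   ≡⟨ regroup a f l x ⟩
  4 * (a + f + l) + x + (f + l)       ≤⟨ +-monoʳ-≤ (4 * (a + f + l) + x) (+-mono-≤ f≤x+x l≤x) ⟩
  4 * (a + f + l) + x + (x + x + x)   ≡⟨ collect a f l x ⟩
  4 * (f + (l + x) + a)               ∎
  where
  open ≤-Reasoning
  regroup : ∀ a f l x → 4 * (a + (f + l)) + (f + (l + x)) ≡ 4 * (a + f + l) + x + (f + l)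
  regroup = solve-∀
  collect : ∀ a f l x → 4 * (a + f + l) + x + (x + x + x) ≡ 4 * (f + (l + x) + a)
  collect = solve-∀
  f≤x+x : f ≤ x + x
  f≤x+x = ≤-trans f≤l+x (+-monoˡ-≤ x l≤x)

module FreePoints {r : ℕ} (G : FinGroup r) (N : Subset r) (N≤G : IsSubgroup G N) (c : Fin r)
  (f₀ : Permutation′ r) (f₀-fixes-cosets : FixesCosets G N f₀)
  (f₀-compatible : Generation.RightCompatible G N N≤G c f₀)
  (m₀ : Fin r) (m₀∈N : m₀ ∈ N) (f₀-moves : f₀ ⟨$⟩ʳ FinGroup._·_ G c m₀ ≢ FinGroup._·_ G c m₀) where
  open GroupFacts G
  open Coset G N N≤G c

  fixed : Fin r → Bool
  fixed x = does (f₀ ⟨$⟩ʳ x Fin.≟ x)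

  fixed-point : ∀ {x} → fixed x ≡ true → f₀ ⟨$⟩ʳ x ≡ x
  fixed-point {x} = does-true (f₀ ⟨$⟩ʳ x Fin.≟ x)

  below : Fin r → Fin r → Bool
  below x y = does (x Fin.<? y)

  local-min : Fin r → Bool
  local-min x = below x (f₀ ⟨$⟩ʳ x) ∧ below x (f₀ ⟨$⟩ˡ x)

  Free : Fin r → Bool
  Free x = not (inC x) ∨ (fixed x ∨ local-min x)

  Outside Fix Moved Min NonMin : Fin r → Bool
  Outside x = not (inC x)
  Fix x = inC x ∧ fixed x
  Moved x = inC x ∧ not (fixed x)
  Min x = Moved x ∧ local-min x
  NonMin x = Moved x ∧ not (local-min x)

  f₀-preserves-C : ∀ x → inC x ≡ true → inC (f₀ ⟨$⟩ʳ x) ≡ true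
  f₀-preserves-C x x∈C = coset-step x _ x∈C (f₀-fixes-cosets x)

  free-split : count Free ≡ count Outside + (count Fix + count Min)
  free-split = begin
    count Free                                                         ≡⟨ count-split Free inC ⟩
    count (λ x → Free x ∧ inC x) + count (λ x → Free x ∧ not (inC x))  ≡⟨ +-comm (count (λ x → Free x ∧ inC x)) _ ⟩
    count (λ x → Free x ∧ not (inC x)) + count (λ x → Free x ∧ inC x)  ≡⟨ cong₂ _+_ (count-ext _ _ (proj₁ ∘ pieces)) (count-split _ fixed) ⟩
    count Outside + (count (λ x → (Free x ∧ inC x) ∧ fixed x) + count (λ x → (Free x ∧ inC x) ∧ not (fixed x)))
                                                                       ≡⟨ cong (count Outside +_) (cong₂ _+_ (count-ext _ _ (proj₁ ∘ proj₂ ∘ pieces)) (count-ext _ _ (proj₂ ∘ proj₂ ∘ pieces))) ⟩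
    count Outside + (count Fix + count Min)                            ∎
    where
    open ≡-Reasoning
    pieces : ∀ x → (Free x ∧ not (inC x)) ≡ Outside x
                 × ((Free x ∧ inC x) ∧ fixed x) ≡ Fix x
                 × ((Free x ∧ inC x) ∧ not (fixed x)) ≡ Min x
    pieces x with inC x | fixed x | local-min x
    ... | true | true | _ = refl , refl , refl
    ... | true | false | true = refl , refl , refl
    ... | true | false | false = refl , refl , refl
    ... | false | _ | _ = refl , refl , refl

  -- f₀ maps local minima injectively to moved points that are not local
  -- minima (the preimage of f₀ x is x, which is smaller).
  min≤nonmin : count Min ≤ count NonMin
  min≤nonmin = count-injection Min NonMin (f₀ ⟨$⟩ʳ_) (λ x y _ _ → perm-injective f₀) image-not-min
    where
    image-not-min : ∀ x → Min x ≡ true → NonMin (f₀ ⟨$⟩ʳ x) ≡ true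
    image-not-min x Min-x = true-∧-true (true-∧-true (f₀-preserves-C x x∈C) (false-not y-moved)) (false-not y-not-min)
      where
      y = f₀ ⟨$⟩ʳ x
      x∈C : inC x ≡ true
      x∈C = proj₁ (∧-true {inC x} (proj₁ (∧-true {Moved x} Min-x)))
      x-moved : f₀ ⟨$⟩ʳ x ≢ x
      x-moved = does-false (f₀ ⟨$⟩ʳ x Fin.≟ x) (not-true (proj₂ (∧-true {inC x} (proj₁ (∧-true {Moved x} Min-x)))))
      x<y : toℕ x < toℕ y
      x<y = does-true (x Fin.<? y) (proj₁ (∧-true (proj₂ (∧-true {Moved x} Min-x))))
      y-moved : fixed y ≡ false
      y-moved = dec-false (f₀ ⟨$⟩ʳ y Fin.≟ y) (λ fy≡y → x-moved (sym (perm-injective f₀ (sym fy≡y))))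
      y-not-min : local-min y ≡ false
      y-not-min with below y (f₀ ⟨$⟩ʳ y)
      ... | false = refl
      ... | true = subst (λ w → below y w ≡ false) (sym (Permutation.inverseˡ f₀)) (dec-false (y Fin.<? x) (<-asym x<y))

  -- If f₀ fixes x₁ ∈ C, then u = x₁⁻¹·c·m₀ ∈ N, and f₀ turns right
  -- multiplication by u into right multiplication by some m′ ≠ u (as f₀ moves
  -- x₁·u = c·m₀); hence f₀ moves x·u for every fixed point x.
  moving-translation : ∀ x₁ → inC x₁ ≡ true → f₀ ⟨$⟩ʳ x₁ ≡ x₁ →
    ∃[ u ] (u ∈ N × (∀ x → f₀ ⟨$⟩ʳ x ≡ x → f₀ ⟨$⟩ʳ (x · u) ≢ x · u))
  moving-translation x₁ x₁∈C f₀x₁≡x₁ = u , u∈N , moves-translates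
    where
    open ≡-Reasoning
    u = x₁ ⁻¹ · (c · m₀)
    w = c ⁻¹ · x₁
    u≡w⁻¹m₀ : w ⁻¹ · m₀ ≡ u
    u≡w⁻¹m₀ = begin
      w ⁻¹ · m₀                       ≡⟨ cong (w ⁻¹ ·_) (x⁻¹·[x·y]≡y c m₀) ⟨
      w ⁻¹ · (c ⁻¹ · (c · m₀))        ≡⟨ assoc _ _ _ ⟨
      w ⁻¹ · c ⁻¹ · (c · m₀)          ≡⟨ cong (_· (c · m₀)) (⁻¹-anti-homo-∙ c w) ⟨
      (c · w) ⁻¹ · (c · m₀)           ≡⟨ cong (λ z → z ⁻¹ · (c · m₀)) (x·[x⁻¹·y]≡y c x₁) ⟩
      u                               ∎
    u∈N : u ∈ N
    u∈N = subst (_∈ N) u≡w⁻¹m₀ (proj₁ (proj₂ N≤G) _ _ (proj₂ (proj₂ N≤G) _ (lookup⇒[]= _ N x₁∈C)) m₀∈N)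
    m′ = proj₁ (f₀-compatible u u∈N)
    shift : ∀ x → f₀ ⟨$⟩ʳ (x · u) ≡ (f₀ ⟨$⟩ʳ x) · m′
    shift = proj₂ (proj₂ (f₀-compatible u u∈N))
    m′≢u : m′ ≢ u
    m′≢u m′≡u = f₀-moves (begin
      f₀ ⟨$⟩ʳ (c · m₀)           ≡⟨ cong (f₀ ⟨$⟩ʳ_) (x·[x⁻¹·y]≡y x₁ (c · m₀)) ⟨
      f₀ ⟨$⟩ʳ (x₁ · u)           ≡⟨ shift x₁ ⟩
      (f₀ ⟨$⟩ʳ x₁) · m′          ≡⟨ cong₂ _·_ f₀x₁≡x₁ m′≡u ⟩
      x₁ · u                     ≡⟨ x·[x⁻¹·y]≡y x₁ (c · m₀) ⟩
      c · m₀                     ∎)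
    moves-translates : ∀ x → f₀ ⟨$⟩ʳ x ≡ x → f₀ ⟨$⟩ʳ (x · u) ≢ x · u
    moves-translates x f₀x≡x f₀xu≡xu = m′≢u (∙-cancelˡ x m′ u (begin
      x · m′               ≡⟨ cong (_· m′) f₀x≡x ⟨
      (f₀ ⟨$⟩ʳ x) · m′     ≡⟨ shift x ⟨
      f₀ ⟨$⟩ʳ (x · u)      ≡⟨ f₀xu≡xu ⟩
      x · u                ∎))

  -- Hence, unless there are no fixed points in C at all, right multiplication
  -- by u maps the fixed points of C injectively to moved points of C.
  fix≤moved : count Fix ≤ count Moved
  fix≤moved with Fin.any? (λ x → Fix x Bool.≟ true)
  ... | no no-fixed = ≤-trans (≤-reflexive (count-empty Fix (λ x → Bool.¬-not (no-fixed ∘ (x ,_))))) z≤n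
  ... | yes (x₁ , Fix-x₁) with moving-translation x₁ (proj₁ (∧-true Fix-x₁)) (fixed-point (proj₂ (∧-true Fix-x₁)))
  ... | u , u∈N , moves-translates = count-injection Fix Moved (_· u) (λ x y _ _ → ∙-cancelʳ u x y) fixed↦moved
    where
    fixed↦moved : ∀ x → Fix x ≡ true → Moved (x · u) ≡ true
    fixed↦moved x Fix-x = true-∧-true
      (coset-step x (x · u) (proj₁ (∧-true Fix-x)) (subst (_∈ N) (sym (x⁻¹·[x·y]≡y x u)) u∈N))
      (false-not (dec-false (f₀ ⟨$⟩ʳ (x · u) Fin.≟ x · u) (moves-translates x (fixed-point (proj₂ (∧-true Fix-x))))))

  free-bound : 4 * count Free + count (lookup N) ≤ 4 * r
  free-bound = begin
    4 * count Free + count (lookup N)                                  ≤⟨ +-monoʳ-≤ (4 * count Free) N≤C ⟩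
    4 * count Free + count inC                                         ≡⟨ cong₂ (λ u v → 4 * u + v) free-split |C| ⟩
    4 * (count Outside + (count Fix + count Min)) + (count Fix + (count Min + count NonMin))
                                                                       ≤⟨ quarter-bound _ _ _ _ min≤nonmin (subst (count Fix ≤_) (count-split Moved local-min) fix≤moved) ⟩
    4 * (count Fix + (count Min + count NonMin) + count Outside)       ≡⟨ cong (λ k → 4 * (k + count Outside)) |C| ⟨
    4 * (count inC + count Outside)                                    ≡⟨ cong (4 *_) |R| ⟨
    4 * r                                                              ∎
    where
    open ≤-Reasoning
    |C| : count inC ≡ count Fix + (count Min + count NonMin)
    |C| = trans (count-split inC fixed) (cong (count Fix +_) (count-split Moved local-min))
    |R| : r ≡ count inC + count Outside
    |R| = trans (sym (count-full (λ _ → true) (λ _ → refl))) (count-split (λ _ → true) inC)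

  Follows : Subset r → Set
  Follows S = ∀ z → inC z ≡ true → lookup S z ≡ lookup S (f₀ ⟨$⟩ʳ z)

  preimage-in-C : ∀ z → inC z ≡ true → inC (f₀ ⟨$⟩ˡ z) ≡ true
  preimage-in-C z z∈C = coset-step⁻ w z z∈C (subst (λ y → (w ⁻¹ · y) ∈ N) (Permutation.inverseʳ f₀) (f₀-fixes-cosets w))
    where w = f₀ ⟨$⟩ˡ z

  not-free : ∀ z → Free z ≡ false → inC z ≡ true × fixed z ≡ false × local-min z ≡ false
  not-free z with inC z | fixed z | local-min z
  ... | true | false | false = λ _ → refl , refl , refl
  ... | true | false | true = λ ()
  ... | true | true | _ = λ ()
  ... | false | _ | _ = λ ()

  smaller-neighbour : ∀ z → fixed z ≡ false → local-min z ≡ false →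
    toℕ (f₀ ⟨$⟩ʳ z) < toℕ z ⊎ toℕ (f₀ ⟨$⟩ˡ z) < toℕ z
  smaller-neighbour z z-moved z-not-min with Fin.<-cmp z (f₀ ⟨$⟩ʳ z)
  ... | tri> _ _ fz<z = inj₁ fz<z
  ... | tri≈ _ z≡fz _ = ⊥-elim (does-false (f₀ ⟨$⟩ʳ z Fin.≟ z) z-moved (sym z≡fz))
  ... | tri< z<fz _ _ with Fin.<-cmp z (f₀ ⟨$⟩ˡ z)
  ...   | tri> _ _ f⁻¹z<z = inj₂ f⁻¹z<z
  ...   | tri≈ _ z≡f⁻¹z _ =
          ⊥-elim (does-false (f₀ ⟨$⟩ʳ z Fin.≟ z) z-moved (trans (cong (f₀ ⟨$⟩ʳ_) z≡f⁻¹z) (Permutation.inverseʳ f₀)))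
  ...   | tri< z<f⁻¹z _ _ with () ← trans (sym z-not-min)
          (true-∧-true (dec-true (z Fin.<? f₀ ⟨$⟩ʳ z) z<fz) (dec-true (z Fin.<? f₀ ⟨$⟩ˡ z) z<f⁻¹z))

  -- Two subsets following f₀ on C that agree on the free points agree
  -- everywhere: by strong induction, a non-free point inherits its value from
  -- a smaller neighbour in its f₀-cycle.
  determined-by-free : ∀ S₁ S₂ → Follows S₁ → Follows S₂ →
    (∀ z → Free z ≡ true → lookup S₁ z ≡ lookup S₂ z) → ∀ z → lookup S₁ z ≡ lookup S₂ z
  determined-by-free S₁ S₂ follows₁ follows₂ agree-on-free z = <-rec P step (toℕ z) z refl
    where
    open ≡-Reasoning
    P : ℕ → Set
    P k = ∀ z → toℕ z ≡ k → lookup S₁ z ≡ lookup S₂ z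
    step : ∀ k → (∀ {j} → j < k → P j) → P k
    step _ smaller z refl with Free z in free-z
    ... | true = agree-on-free z free-z
    ... | false with not-free z free-z
    ... | z∈C , z-moved , z-not-min with smaller-neighbour z z-moved z-not-min
    ... | inj₁ fz<z = begin
          lookup S₁ z              ≡⟨ follows₁ z z∈C ⟩
          lookup S₁ (f₀ ⟨$⟩ʳ z)    ≡⟨ smaller fz<z _ refl ⟩
          lookup S₂ (f₀ ⟨$⟩ʳ z)    ≡⟨ follows₂ z z∈C ⟨
          lookup S₂ z              ∎
    ... | inj₂ f⁻¹z<z = begin
          lookup S₁ z              ≡⟨ cong (lookup S₁) (Permutation.inverseʳ f₀) ⟨
          lookup S₁ (f₀ ⟨$⟩ʳ w)    ≡⟨ follows₁ w w∈C ⟨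
          lookup S₁ w              ≡⟨ smaller f⁻¹z<z w refl ⟩
          lookup S₂ w              ≡⟨ follows₂ w w∈C ⟩
          lookup S₂ (f₀ ⟨$⟩ʳ w)    ≡⟨ cong (lookup S₂) (Permutation.inverseʳ f₀) ⟩
          lookup S₂ z              ∎
      where
      w = f₀ ⟨$⟩ˡ z
      w∈C = preimage-in-C z z∈C

  restrict : Subset r → Subset r
  restrict S = tabulate (λ z → lookup S z ∧ Free z)

  -- Distinct subsets following f₀ on C number at most 2 ^ |Free|: each is
  -- determined by its restriction to the free points.
  following-count : ∀ {A : Set} (set : A → Subset r) (L : List A) →
    AllPairs (λ x y → set x ≢ set y) L → All (λ x → Follows (set x)) L → length L ≤ 2 ^ count Free
  following-count set L distinct following = begin
    length L                              ≡⟨ length-map (restrict ∘ set) L ⟨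
    length (map (restrict ∘ set) L)       ≤⟨ pigeonhole _ (subsetsWithin Free) restrictions-unique restrictions-free ⟩
    length (subsetsWithin Free)           ≡⟨ length-subsetsWithin Free ⟩
    2 ^ count Free                        ∎
    where
    open ≤-Reasoning
    restriction-free : ∀ x z → lookup (restrict (set x)) z ≡ true → Free z ≡ true
    restriction-free x z in-restriction = proj₂ (∧-true {lookup (set x) z} (trans (sym (lookup∘tabulate _ z)) in-restriction))
    on-free : ∀ S z → Free z ≡ true → lookup (restrict S) z ≡ lookup S z
    on-free S z free-z = trans (lookup∘tabulate _ z) (trans (cong (lookup S z ∧_) free-z) (Bool.∧-identityʳ _))
    separates : ∀ {x y} → x ∈ₗ L → y ∈ₗ L → set x ≢ set y → restrict (set x) ≢ restrict (set y)
    separates {x} {y} x∈L y∈L set-x≢set-y restrictions≡ = set-x≢set-y (subset-ext (set x) (set y)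
      (determined-by-free (set x) (set y) (All.lookup following x∈L) (All.lookup following y∈L) agree-on-free))
      where
      agree-on-free : ∀ z → Free z ≡ true → lookup (set x) z ≡ lookup (set y) z
      agree-on-free z free-z =
        trans (sym (on-free (set x) z free-z)) (trans (cong (λ T → lookup T z) restrictions≡) (on-free (set y) z free-z))
    restrictions-unique : Unique (map (restrict ∘ set) L)
    restrictions-unique = map-separating (restrict ∘ set) separates distinct
    restrictions-free : All (_∈ₗ subsetsWithin Free) (map (restrict ∘ set) L)
    restrictions-free = All.map⁺ (All.universal (λ x → ∈-subsetsWithin Free (restrict (set x)) (restriction-free x)) L)

^-swap : ∀ a b c → (a ^ b) ^ c ≡ (a ^ c) ^ b
^-swap a b c = trans (^-*-assoc a b c) (trans (cong (a ^_) (*-comm b c)) (sym (^-*-assoc a c b)))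

^-distribʳ-* : ∀ a b m → (a * b) ^ m ≡ a ^ m * b ^ m
^-distribʳ-* a b zero = refl
^-distribʳ-* a b (suc m) = trans (cong (a * b *_) (^-distribʳ-* a b m)) (interchange a b (a ^ m) (b ^ m))
  where
  interchange : ∀ a b x y → a * b * (x * y) ≡ a * x * (b * y)
  interchange = solve-∀

-- The counting bound k ≤ n^(d+1)·2^M with 4M + n ≤ 4r, raised to the fourth
-- power to clear the quarter: k⁴·2ⁿ ≤ 2^(4r)·n⁴·(n^d)⁴.
fourth-power-bound : ∀ k n r d M → k ≤ n ^ suc d * 2 ^ M → 4 * M + n ≤ 4 * r →
  k ^ 4 * 2 ^ n ≤ 2 ^ (4 * r) * n ^ 4 * (n ^ d) ^ 4
fourth-power-bound k n r d M k≤ M≤ = begin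
  k ^ 4 * 2 ^ n                                  ≤⟨ *-monoˡ-≤ (2 ^ n) (^-monoˡ-≤ 4 k≤) ⟩
  (n * n ^ d * 2 ^ M) ^ 4 * 2 ^ n                ≡⟨ cong (_* 2 ^ n) expand ⟩
  n ^ 4 * (n ^ d) ^ 4 * (2 ^ M) ^ 4 * 2 ^ n      ≡⟨ regroup (n ^ 4) ((n ^ d) ^ 4) ((2 ^ M) ^ 4) (2 ^ n) ⟩
  (2 ^ M) ^ 4 * 2 ^ n * (n ^ 4 * (n ^ d) ^ 4)    ≡⟨ cong (_* (n ^ 4 * (n ^ d) ^ 4)) powers-of-2 ⟩
  2 ^ (4 * M + n) * (n ^ 4 * (n ^ d) ^ 4)        ≤⟨ *-monoˡ-≤ (n ^ 4 * (n ^ d) ^ 4) (^-monoʳ-≤ 2 M≤) ⟩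
  2 ^ (4 * r) * (n ^ 4 * (n ^ d) ^ 4)            ≡⟨ *-assoc (2 ^ (4 * r)) (n ^ 4) ((n ^ d) ^ 4) ⟨
  2 ^ (4 * r) * n ^ 4 * (n ^ d) ^ 4              ∎
  where
  open ≤-Reasoning
  expand : (n * n ^ d * 2 ^ M) ^ 4 ≡ n ^ 4 * (n ^ d) ^ 4 * (2 ^ M) ^ 4
  expand = trans (^-distribʳ-* (n * n ^ d) (2 ^ M) 4) (cong (_* (2 ^ M) ^ 4) (^-distribʳ-* n (n ^ d) 4))
  regroup : ∀ a b c d → a * b * c * d ≡ c * d * (a * b)
  regroup = solve-∀
  powers-of-2 : (2 ^ M) ^ 4 * 2 ^ n ≡ 2 ^ (4 * M + n)
  powers-of-2 = trans (cong (_* 2 ^ n) (trans (^-*-assoc 2 M 4) (cong (2 ^_) (*-comm M 4)))) (sym (^-distribˡ-+-* 2 (4 * M) n))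

-- With d ≤ log₂ n and log₂ n < p/q:  (n^d)^(q²) ≤ 2^(p²), since d·q < p.
log-bound : ∀ n d p q → 2 ^ d ≤ n → n ^ q < 2 ^ p → (n ^ d) ^ (q * q) ≤ 2 ^ (p * p)
log-bound n d p q 2^d≤n n^q<2^p = begin
  (n ^ d) ^ (q * q)      ≡⟨ ^-*-assoc n d (q * q) ⟩
  n ^ (d * (q * q))      ≡⟨ cong (n ^_) (reorder d q) ⟩
  n ^ (q * (d * q))      ≡⟨ ^-*-assoc n q (d * q) ⟨
  (n ^ q) ^ (d * q)      ≤⟨ ^-monoˡ-≤ (d * q) (<⇒≤ n^q<2^p) ⟩
  (2 ^ p) ^ (d * q)      ≡⟨ ^-*-assoc 2 p (d * q) ⟩
  2 ^ (p * (d * q))      ≤⟨ ^-monoʳ-≤ 2 (*-monoʳ-≤ p (<⇒≤ dq<p)) ⟩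
  2 ^ (p * p)            ∎
  where
  open ≤-Reasoning
  reorder : ∀ d q → d * (q * q) ≡ q * (d * q)
  reorder = solve-∀
  2^dq<2^p : 2 ^ (d * q) < 2 ^ p
  2^dq<2^p = ≤-<-trans (≤-trans (≤-reflexive (sym (^-*-assoc 2 d q))) (^-monoˡ-≤ q 2^d≤n)) n^q<2^p
  dq<p : d * q < p
  dq<p = ≰⇒> (λ p≤dq → <⇒≱ 2^dq<2^p (^-monoʳ-≤ 2 p≤dq))

bound-from-counts : ∀ k n r d M → k ≤ n ^ suc d * 2 ^ M → 4 * M + n ≤ 4 * r → 2 ^ d ≤ n → BoundedBy k r n
bound-from-counts k n r d M k≤ M≤ 2^d≤n p q _ n^q<2^p = begin
  (k ^ 4 * 2 ^ n) ^ (q * q)                                   ≤⟨ ^-monoˡ-≤ (q * q) (fourth-power-bound k n r d M k≤ M≤) ⟩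
  (2 ^ (4 * r) * n ^ 4 * (n ^ d) ^ 4) ^ (q * q)               ≡⟨ ^-distribʳ-* (2 ^ (4 * r) * n ^ 4) ((n ^ d) ^ 4) (q * q) ⟩
  (2 ^ (4 * r) * n ^ 4) ^ (q * q) * ((n ^ d) ^ 4) ^ (q * q)   ≤⟨ *-monoʳ-≤ ((2 ^ (4 * r) * n ^ 4) ^ (q * q)) log-part ⟩
  (2 ^ (4 * r) * n ^ 4) ^ (q * q) * 2 ^ (4 * (p * p))         ∎
  where
  open ≤-Reasoning
  log-part : ((n ^ d) ^ 4) ^ (q * q) ≤ 2 ^ (4 * (p * p))
  log-part = begin
    ((n ^ d) ^ 4) ^ (q * q)    ≡⟨ ^-swap (n ^ d) 4 (q * q) ⟩
    ((n ^ d) ^ (q * q)) ^ 4    ≤⟨ ^-monoˡ-≤ 4 (log-bound n d p q 2^d≤n n^q<2^p) ⟩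
    (2 ^ (p * p)) ^ 4          ≡⟨ trans (^-*-assoc 2 (p * p) 4) (cong (2 ^_) (*-comm (p * p) 4)) ⟩
    2 ^ (4 * (p * p))          ∎

-- ⌊(4r − n)/4⌋: the number of free points allowed by "at most r − n/4".
free-budget : ℕ → ℕ → ℕ
free-budget r n = (4 * r ∸ n) / 4

within-budget : ∀ f r n → 4 * f + n ≤ 4 * r → f ≤ free-budget r n
within-budget f r n 4f+n≤4r = begin
  f                  ≡⟨ m*n/n≡m f 4 ⟨
  f * 4 / 4          ≤⟨ /-monoˡ-≤ 4 (≤-trans (≤-reflexive (*-comm f 4)) 4f≤4r-n) ⟩
  (4 * r ∸ n) / 4    ∎
  where
  open ≤-Reasoning
  4f≤4r-n : 4 * f ≤ 4 * r ∸ n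
  4f≤4r-n = ≤-trans (≤-reflexive (sym (m+n∸n≡m (4 * f) n))) (∸-monoˡ-≤ n 4f+n≤4r)

budget-bound : ∀ r n → n ≤ r → 4 * free-budget r n + n ≤ 4 * r
budget-bound r n n≤r = begin
  4 * free-budget r n + n    ≡⟨ cong (_+ n) (*-comm 4 (free-budget r n)) ⟩
  free-budget r n * 4 + n    ≤⟨ +-monoˡ-≤ n (m/n*n≤m (4 * r ∸ n) 4) ⟩
  4 * r ∸ n + n              ≡⟨ m∸n+n≡m (≤-trans n≤r (m≤n*m r 4)) ⟩
  4 * r                      ∎
  where open ≤-Reasoning

map-proj₁-toList : ∀ {A : Set} {P : A → Set} {L : List A} (ps : All P L) → map proj₁ (All.toList ps) ≡ L
map-proj₁-toList [] = refl
map-proj₁-toList (_ ∷ ps) = cong (_ ∷_) (map-proj₁-toList ps)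

module GoodCount {r : ℕ} (G : FinGroup r) (N : Subset r) (N≤G : IsSubgroup G N) (c : Fin r) where
  open GroupFacts G
  open Generation G N N≤G c
  open Coset G N N≤G c
  open CayleyFacts G
  open GeneratingSequence generating-sequence

  n : ℕ
  n = count (lookup N)

  M : ℕ
  M = free-budget r n

  d : ℕ
  d = length gens

  2^d≤n : 2 ^ d ≤ n
  2^d≤n = logarithmic

  Witness : Set
  Witness = Σ (Subset r) (Good G N c)

  Distinct : Witness → Witness → Set
  Distinct w₁ w₂ = proj₁ w₁ ≢ proj₁ w₂

  automorphism : Witness → Permutation′ r
  automorphism (_ , f , _) = f

  coordinate : Fin r → Witness → Fin r
  coordinate g w = (c · g) ⁻¹ · (automorphism w ⟨$⟩ʳ (c · g))

  coordinate∈N : ∀ g w → lookup N (coordinate g w) ≡ true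
  coordinate∈N g (_ , _ , _ , fixes-cosets , _) = []=⇒lookup (fixes-cosets (c · g))

  coordinates : List (Witness → Fin r)
  coordinates = map coordinate (e ∷ gens)

  open Classification Distinct (Fin._≟_ {r})

  agree-on-C : ∀ w₁ w₂ → key coordinates w₁ ≡ key coordinates w₂ →
    ∀ z → inC z ≡ true → automorphism w₁ ⟨$⟩ʳ z ≡ automorphism w₂ ⟨$⟩ʳ z
  agree-on-C w₁@(_ , _ , _ , _ , (compatible₁ , _) , _) w₂@(_ , _ , _ , _ , (compatible₂ , _) , _) keys≡ z z∈C =
    subst (Agree (automorphism w₁) (automorphism w₂)) (x·[x⁻¹·y]≡y c z)
      (determines (automorphism w₁) (automorphism w₂) compatible₁ compatible₂ agree-on-gens (c ⁻¹ · z) z∈C)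
    where
    agree-on-gens : AgreeOn (automorphism w₁) (automorphism w₂) gens
    agree-on-gens = All.map (λ {g} → ∙-cancelˡ ((c · g) ⁻¹) _ _) (All.map⁻ (same-key coordinates keys≡))

  -- Witnesses sharing a key are at most 2 ^ M in number: all follow the
  -- automorphism f₀ of the first one on C, so FreePoints applies to f₀.
  fibre-bound : ∀ v → Bounded (λ w → ⊤ × key coordinates w ≡ v) (2 ^ M)
  fibre-bound v [] _ _ = z≤n
  fibre-bound v L@(w₀@(_ , f₀ , _ , fixes-cosets₀ , (compatible₀ , _) , _ , m₀ , m₀∈N , moves₀) ∷ _)
              distinct in-fibre =
    ≤-trans (following-count proj₁ L distinct (All.map follows-f₀ in-fibre)) (^-monoʳ-≤ 2 free≤M)
    where
    open FreePoints G N N≤G c f₀ fixes-cosets₀ compatible₀ m₀ m₀∈N moves₀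
    free≤M : count Free ≤ M
    free≤M = within-budget (count Free) r n free-bound
    follows-f₀ : ∀ {w} → ⊤ × key coordinates w ≡ v → Follows (proj₁ w)
    follows-f₀ {w@(S , f , aut , _ , _ , f-fixes-e , _)} (_ , key≡v) z z∈C =
      trans (aut-preserves-connection-set S f aut f-fixes-e z)
        (cong (lookup S) (agree-on-C w w₀ (trans key≡v (sym (proj₂ (All.head in-fibre)))) z z∈C))

  witness-count : Bounded (λ _ → ⊤) (n ^ suc d * 2 ^ M)
  witness-count L distinct _ =
    subst₂ (λ size k → length L ≤ size ^ k * 2 ^ M) (enum-length (lookup N)) (length-map coordinate (e ∷ gens))
      (classify (enum (lookup N)) coordinates fibre-bound L distinct
        (All.universal (λ w → tt , All.map⁺ (All.universal (λ g → ∈-enum (lookup N) _ (coordinate∈N g w)) (e ∷ gens))) L))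

  good-count : ∀ L → Unique L → All (Good G N c) L → length L ≤ n ^ suc d * 2 ^ M
  good-count L unique good =
    subst (_≤ n ^ suc d * 2 ^ M) (trans (sym (length-map proj₁ witnesses)) (cong length same-entries))
      (witness-count witnesses (AllPairs.map⁻ (subst Unique (sym same-entries) unique)) (All.universal (λ _ → tt) witnesses))
    where
    witnesses : List Witness
    witnesses = All.toList good
    same-entries : map proj₁ witnesses ≡ L
    same-entries = map-proj₁-toList good

lemma2p2 : (r : ℕ) (G : FinGroup r) (N : Subset r) →
    IsNormalSubgroup G N → NonTrivial G N → Proper G N →
    (c : Fin r) → c ∉ N →
    (L : List (Subset r)) → Unique L → All (Good G N c) L →
    BoundedBy (length L) r ∣ N ∣
lemma2p2 r G N (N≤G , _) _ _ c _ L unique good =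
  subst (BoundedBy (length L) r) (sym (∣∣≡count N))
    (bound-from-counts (length L) n r d M (good-count L unique good) (budget-bound r n (count-≤ (lookup N))) 2^d≤n)
  where open GoodCount G N N≤G c
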